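{- Let $p$ and $q$ be distinct odd primes and let $k\ge 2$ be an integer. Write $p=2^a d\alpha+1$ and $q=2^b d\beta+1$ with $a,b\ge 1$, $d,\alpha,\beta$ odd positive integers and $\gcd(\alpha,\beta)=1$, where $p,q$ are labelled so that $a\le b$. Then $n=pq\in L_k$ if and only if $a+b\le ka$ and $\alpha\beta\mid d^{k-2}$.
   Context: $\varphi$ is Euler's totient function. For $k\in\mathbb{N}$, $L_k=\{n\in\mathbb{N} : \varphi(n)\mid (n-1)^k\}$. -}

module Defs where

open import Data.Nat.GCD using (gcd)
open import Data.Nat.Divisibility using (_∣_)
open import Data.List using (length; filter; upTo)
open import Relation.Nullary.Decidable using (does)
open import Data.Nat using (ℕ; suc; _∸_; _^_; _≟_)

-- Euler's totient: φ n = #{ m : 1 ≤ m ≤ n , gcd m n ≡ 1 }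
-- (upTo n = [0 , … , n-1]; we count i with gcd (suc i) n ≡ 1).
φ : ℕ → ℕ
φ n = length (filter (λ i → gcd (suc i) n ≟ 1) (upTo n))

InL : ℕ → ℕ → Set
InL k n = φ n ∣ (n ∸ 1) ^ k

module Submission where

-- Write p - 1 = 2^a d α and q - 1 = 2^(a+e) d β (so b = a + e).  Then
--   φ(pq)  = (p - 1)(q - 1) = (2^a d)² · 2^e α β,
--   pq - 1 = (p - 1)(q - 1) + (p - 1) + (q - 1) = 2^a d · X,
-- where X = α (q - 1) + α + 2^e β.  Cancelling (2^a d)², with k = j + 2,
--   φ(pq) ∣ (pq - 1)^k  ⇔  2^e α β ∣ 2^(a j) d^j X^k.
-- X is coprime to α and to β, and X is odd as soon as e ≥ 1; so the 2-part
-- of the divisibility says e ≤ a j (i.e. a + b ≤ k a) and the odd part says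
-- α β ∣ d^j.

open import Defs
open import Data.Nat using (ℕ; _+_; _*_; _∸_; _^_; _≤_)
open import Data.Nat.Primality using (Prime)
open import Data.Nat.Divisibility using (_∣_)
open import Data.Nat.Coprimality using (Coprime)
open import Data.Product using (_×_)
open import Relation.Nullary using (¬_)
open import Function.Bundles using (_⇔_)
open import Relation.Binary.PropositionalEquality using (_≡_; _≢_)

open import Agda.Primitive using (lzero)
open import Data.Empty using (⊥-elim)
open import Data.List using (length; filter; upTo; _++_; [_])
open import Data.List.Properties using (length-++; filter-++; upTo-∷ʳ)
open import Data.Nat using (zero; suc; NonZero; _≟_; s≤s; z≤n; nonTrivial⇒≢1)
open import Data.Nat.Properties
open import Data.Nat.Divisibility
  using (divides; _∣?_; ∣-refl; ∣-trans; ∣1⇒≡1; ∣⇒≤; ∣m+n∣m⇒∣n; ∣m∣n⇒∣m+n;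
         m∣m*n; n∣m*n; ∣m⇒∣m*n; ∣n⇒∣m*n; m*n∣⇒m∣; m*n∣⇒n∣; *-pres-∣; *-monoʳ-∣;
         *-cancelˡ-∣)
open import Data.Nat.GCD using (gcd; gcd-greatest)
open import Data.Nat.Coprimality using (coprime⇒gcd≡1; coprime-divisor; coprime-factors)
  renaming (sym to coprime-sym)
open import Data.Nat.Primality using (prime[2]; prime⇒nonZero; prime⇒nonTrivial; prime⇒irreducible; euclidsLemma)
open import Data.Nat.Tactic.RingSolver using (solve-∀)
open import Data.Product using (_,_)
open import Data.Sum using (inj₁; inj₂)
open import Function.Bundles using (mk⇔)
open import Function.Construct.Composition using (_⇔-∘_)
open import Data.Product.Function.NonDependent.Propositional using (_×-⇔_)
import Function.Properties.Equivalence as ⇔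
open import Relation.Nullary using (Dec; yes; no)
open import Relation.Unary using (Pred; Decidable)
open import Relation.Binary.PropositionalEquality
  using (refl; sym; trans; cong; cong₂; subst; subst₂; module ≡-Reasoning)

indicator : {P : Set} → Dec P → ℕ
indicator (yes _) = 1
indicator (no _)  = 0

indicator-yes : {P : Set} (P? : Dec P) → P → indicator P? ≡ 1
indicator-yes (yes _) _  = refl
indicator-yes (no ¬p) p  = ⊥-elim (¬p p)

indicator-no : {P : Set} (P? : Dec P) → ¬ P → indicator P? ≡ 0
indicator-no (yes p) ¬p = ⊥-elim (¬p p)
indicator-no (no _)  _  = refl

count : {P : Pred ℕ lzero} → Decidable P → ℕ → ℕ
count P? n = length (filter P? (upTo n))

count-suc : {P : Pred ℕ lzero} (P? : Decidable P) (n : ℕ) →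
            count P? (suc n) ≡ count P? n + indicator (P? n)
count-suc P? n = begin
  length (filter P? (upTo (suc n)))              ≡⟨ cong (λ l → length (filter P? l)) (sym (upTo-∷ʳ n)) ⟩
  length (filter P? (upTo n ++ [ n ]))           ≡⟨ cong length (filter-++ P? (upTo n) [ n ]) ⟩
  length (filter P? (upTo n) ++ filter P? [ n ]) ≡⟨ length-++ (filter P? (upTo n)) ⟩
  count P? n + length (filter P? [ n ])          ≡⟨ cong (count P? n +_) (singleton P? n) ⟩
  count P? n + indicator (P? n)                  ∎
  where
  open ≡-Reasoning
  singleton : {P : Pred ℕ lzero} (P? : Decidable P) (n : ℕ) →
              length (filter P? [ n ]) ≡ indicator (P? n)
  singleton P? n with P? n
  ... | yes _ = refl
  ... | no _  = refl

count-inclusion-exclusion :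
  {F A B AB : Pred ℕ lzero}
  (F? : Decidable F) (A? : Decidable A) (B? : Decidable B) (AB? : Decidable AB) →
  (∀ i → indicator (F? i) + indicator (A? i) + indicator (B? i) ≡ 1 + indicator (AB? i)) →
  ∀ n → count F? n + count A? n + count B? n ≡ n + count AB? n
count-inclusion-exclusion F? A? B? AB? pointwise zero = refl
count-inclusion-exclusion F? A? B? AB? pointwise (suc n)
  rewrite count-suc F? n | count-suc A? n | count-suc B? n | count-suc AB? n = begin
    (x + u) + (y + v) + (z + w)   ≡⟨ regroup x y z u v w ⟩
    (x + y + z) + (u + v + w)     ≡⟨ cong₂ _+_ (count-inclusion-exclusion F? A? B? AB? pointwise n) (pointwise n) ⟩
    (n + c) + (1 + t)             ≡⟨ shift n c t ⟩
    suc n + (c + t)               ∎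
  where
  open ≡-Reasoning
  x y z c u v w t : ℕ
  x = count F? n ; y = count A? n ; z = count B? n ; c = count AB? n
  u = indicator (F? n) ; v = indicator (A? n) ; w = indicator (B? n) ; t = indicator (AB? n)
  regroup : ∀ x y z u v w → (x + u) + (y + v) + (z + w) ≡ (x + y + z) + (u + v + w)
  regroup = solve-∀
  shift : ∀ n c t → (n + c) + (1 + t) ≡ suc n + (c + t)
  shift = solve-∀

-- multiple? m i decides m ∣ i + 1, so count (multiple? m) n counts the
-- multiples of m in 1 … n.
multiple? : (m : ℕ) → Decidable (λ i → m ∣ suc i)
multiple? m i = m ∣? suc i

count-multiples : ∀ m′ c r → r ≤ m′ → count (multiple? (suc m′)) (c * suc m′ + r) ≡ c
count-multiples m′ zero    zero    _   = refl
count-multiples m′ (suc c) zero    _   = begin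
  count M (suc c * m + 0)                         ≡⟨ cong (count M) last-block ⟩
  count M (suc (c * m + m′))                      ≡⟨ count-suc M (c * m + m′) ⟩
  count M (c * m + m′) + indicator (M (c * m + m′)) ≡⟨ cong₂ _+_ (count-multiples m′ c m′ ≤-refl)
                                                                (indicator-yes (M _) m∣) ⟩
  c + 1                                           ≡⟨ +-comm c 1 ⟩
  suc c                                           ∎
  where
  open ≡-Reasoning
  m : ℕ
  m = suc m′
  M : Decidable (λ i → m ∣ suc i)
  M = multiple? m
  last-block : suc c * m + 0 ≡ suc (c * m + m′)
  last-block = trans (+-identityʳ (suc c * m)) (cong suc (+-comm m′ (c * m)))
  m∣ : m ∣ suc (c * m + m′)
  m∣ = subst (m ∣_) last-block (subst (m ∣_) (sym (+-identityʳ _)) (n∣m*n (suc c)))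
count-multiples m′ c       (suc r) r<m = begin
  count M (c * m + suc r)                        ≡⟨ cong (count M) (+-suc (c * m) r) ⟩
  count M (suc (c * m + r))                      ≡⟨ count-suc M (c * m + r) ⟩
  count M (c * m + r) + indicator (M (c * m + r)) ≡⟨ cong₂ _+_ (count-multiples m′ c r (<⇒≤ r<m))
                                                               (indicator-no (M _) m∤) ⟩
  c + 0                                          ≡⟨ +-identityʳ c ⟩
  c                                              ∎
  where
  open ≡-Reasoning
  m : ℕ
  m = suc m′
  M : Decidable (λ i → m ∣ suc i)
  M = multiple? m
  m∤ : ¬ m ∣ suc (c * m + r)
  m∤ m∣ = <⇒≱ (s≤s r<m) (∣⇒≤ (∣m+n∣m⇒∣n (subst (m ∣_) (sym (+-suc (c * m) r)) m∣) (n∣m*n c)))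

count-multiples-exact : ∀ m .{{_ : NonZero m}} c → count (multiple? m) (c * m) ≡ c
count-multiples-exact (suc m′) c =
  trans (cong (count (multiple? (suc m′))) (sym (+-identityʳ (c * suc m′))))
        (count-multiples m′ c zero z≤n)

coprime-*ʳ : ∀ {m n o} → Coprime m n → Coprime m o → Coprime m (n * o)
coprime-*ʳ {o = o} m⊥n m⊥o (c∣m , c∣no) = m⊥o (c∣m , coprime-factors m⊥n (∣m⇒∣m*n o c∣m , c∣no))

coprime-*ˡ : ∀ {m n o} → Coprime m o → Coprime n o → Coprime (m * n) o
coprime-*ˡ m⊥o n⊥o = coprime-sym (coprime-*ʳ (coprime-sym m⊥o) (coprime-sym n⊥o))

coprime-^ʳ : ∀ {m n} k → Coprime m n → Coprime m (n ^ k)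
coprime-^ʳ zero    _   (_ , c∣1) = ∣1⇒≡1 c∣1
coprime-^ʳ (suc k) m⊥n = coprime-*ʳ m⊥n (coprime-^ʳ k m⊥n)

coprime-^ˡ : ∀ {m n} k → Coprime m n → Coprime (m ^ k) n
coprime-^ˡ k m⊥n = coprime-sym (coprime-^ʳ k (coprime-sym m⊥n))

∤⇒coprime : ∀ {p m} → Prime p → ¬ p ∣ m → Coprime m p
∤⇒coprime p-prime p∤m (c∣m , c∣p) with prime⇒irreducible p-prime c∣p
... | inj₁ c≡1 = c≡1
... | inj₂ refl = ⊥-elim (p∤m c∣m)

coprime-2⇒odd : ∀ {m} → Coprime m 2 → ¬ 2 ∣ m
coprime-2⇒odd m⊥2 2∣m with m⊥2 (2∣m , ∣-refl)
... | ()

odd-* : ∀ {m n} → ¬ 2 ∣ m → ¬ 2 ∣ n → ¬ 2 ∣ m * n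
odd-* m-odd n-odd = coprime-2⇒odd (coprime-*ˡ (∤⇒coprime prime[2] m-odd) (∤⇒coprime prime[2] n-odd))

odd-^ : ∀ {m} k → ¬ 2 ∣ m → ¬ 2 ∣ m ^ k
odd-^ k m-odd = coprime-2⇒odd (coprime-^ˡ k (∤⇒coprime prime[2] m-odd))

odd⇒nonZero : ∀ {m} → ¬ 2 ∣ m → NonZero m
odd⇒nonZero {zero}  m-odd = ⊥-elim (m-odd (divides 0 refl))
odd⇒nonZero {suc _} _     = _

common-prime⇒gcd≢1 : ∀ {p m n} → Prime p → p ∣ m → p ∣ n → gcd m n ≢ 1
common-prime⇒gcd≢1 p-prime p∣m p∣n gcd≡1 =
  nonTrivial⇒≢1 {{prime⇒nonTrivial p-prime}} (∣1⇒≡1 (subst (_ ∣_) gcd≡1 (gcd-greatest p∣m p∣n)))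

distinct-primes-∣ : ∀ {p q m} → Prime p → Prime q → p ≢ q → p ∣ m → q ∣ m → p * q ∣ m
distinct-primes-∣ {p} {q} p-prime q-prime p≢q (divides t refl) q∣tp
  with euclidsLemma t p q-prime q∣tp
... | inj₁ q∣t = subst (p * q ∣_) (*-comm p t) (*-monoʳ-∣ p q∣t)
... | inj₂ q∣p with prime⇒irreducible p-prime q∣p
...   | inj₁ q≡1 = ⊥-elim (nonTrivial⇒≢1 {{prime⇒nonTrivial q-prime}} q≡1)
...   | inj₂ q≡p = ⊥-elim (p≢q (sym q≡p))

module _ {p q : ℕ} (p-prime : Prime p) (q-prime : Prime q) (p≢q : p ≢ q) where

  coprime? : Decidable (λ i → gcd (suc i) (p * q) ≡ 1)
  coprime? i = gcd (suc i) (p * q) ≟ 1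

  totient-pointwise : ∀ i → indicator (coprime? i) + indicator (multiple? p i) + indicator (multiple? q i)
                            ≡ 1 + indicator (multiple? (p * q) i)
  totient-pointwise i with multiple? p i | multiple? q i
  ... | yes p∣x | yes q∣x
    rewrite indicator-no (coprime? i) (common-prime⇒gcd≢1 p-prime p∣x (m∣m*n q))
          | indicator-yes (multiple? (p * q) i) (distinct-primes-∣ p-prime q-prime p≢q p∣x q∣x) = refl
  ... | yes p∣x | no q∤x
    rewrite indicator-no (coprime? i) (common-prime⇒gcd≢1 p-prime p∣x (m∣m*n q))
          | indicator-no (multiple? (p * q) i) (λ pq∣x → q∤x (∣-trans (n∣m*n p) pq∣x)) = refl
  ... | no p∤x | yes q∣x
    rewrite indicator-no (coprime? i) (common-prime⇒gcd≢1 q-prime q∣x (n∣m*n p))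
          | indicator-no (multiple? (p * q) i) (λ pq∣x → p∤x (∣-trans (m∣m*n q) pq∣x)) = refl
  ... | no p∤x | no q∤x
    rewrite indicator-yes (coprime? i) (coprime⇒gcd≡1 (coprime-*ʳ (∤⇒coprime p-prime p∤x) (∤⇒coprime q-prime q∤x)))
          | indicator-no (multiple? (p * q) i) (λ pq∣x → p∤x (∣-trans (m∣m*n q) pq∣x)) = refl

  totient-semiprime : φ (p * q) + q + p ≡ p * q + 1
  totient-semiprime = begin
    φ (p * q) + q + p
      ≡⟨ cong₂ (λ x y → φ (p * q) + x + y) (sym multiples-of-p) (sym multiples-of-q) ⟩
    φ (p * q) + count (multiple? p) (p * q) + count (multiple? q) (p * q)
      ≡⟨ count-inclusion-exclusion coprime? (multiple? p) (multiple? q) (multiple? (p * q)) totient-pointwise (p * q) ⟩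
    p * q + count (multiple? (p * q)) (p * q)
      ≡⟨ cong (p * q +_) multiples-of-pq ⟩
    p * q + 1 ∎
    where
    open ≡-Reasoning
    instance
      p≢0 : NonZero p
      p≢0 = prime⇒nonZero p-prime
      q≢0 : NonZero q
      q≢0 = prime⇒nonZero q-prime
      pq≢0 : NonZero (p * q)
      pq≢0 = m*n≢0 p q
    multiples-of-p : count (multiple? p) (p * q) ≡ q
    multiples-of-p = trans (cong (count (multiple? p)) (*-comm p q)) (count-multiples-exact p q)
    multiples-of-q : count (multiple? q) (p * q) ≡ p
    multiples-of-q = count-multiples-exact q p
    multiples-of-pq : count (multiple? (p * q)) (p * q) ≡ 1
    multiples-of-pq = trans (cong (count (multiple? (p * q))) (sym (*-identityˡ (p * q))))
                            (count-multiples-exact (p * q) 1)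

totient-shifted : ∀ P Q → Prime (P + 1) → Prime (Q + 1) → P + 1 ≢ Q + 1 → φ ((P + 1) * (Q + 1)) ≡ P * Q
totient-shifted P Q p-prime q-prime p≢q =
  +-cancelʳ-≡ ((Q + 1) + (P + 1)) (φ pq) (P * Q) (begin
    φ pq + ((Q + 1) + (P + 1)) ≡⟨ sym (+-assoc (φ pq) (Q + 1) (P + 1)) ⟩
    φ pq + (Q + 1) + (P + 1)   ≡⟨ totient-semiprime p-prime q-prime p≢q ⟩
    pq + 1                     ≡⟨ expand P Q ⟩
    P * Q + ((Q + 1) + (P + 1)) ∎)
  where
  open ≡-Reasoning
  pq : ℕ
  pq = (P + 1) * (Q + 1)
  expand : ∀ P Q → (P + 1) * (Q + 1) + 1 ≡ P * Q + ((Q + 1) + (P + 1))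
  expand = solve-∀

^-distribʳ-* : ∀ m n k → (m * n) ^ k ≡ m ^ k * n ^ k
^-distribʳ-* m n zero    = refl
^-distribʳ-* m n (suc k) =
  trans (cong (m * n *_) (^-distribʳ-* m n k)) (interchange m n (m ^ k) (n ^ k))
  where
  interchange : ∀ m n x y → m * n * (x * y) ≡ m * x * (n * y)
  interchange = solve-∀

^-monoʳ-∣ : ∀ m {e f} → e ≤ f → m ^ e ∣ m ^ f
^-monoʳ-∣ m {e} e≤f with r , refl ← m≤n⇒∃[o]m+o≡n e≤f =
  subst (m ^ e ∣_) (sym (^-distribˡ-+-* m e r)) (m∣m*n (m ^ r))

-- If m^e ∣ m^f · Y and m ∤ Y then e ≤ f: otherwise m^(f+1) ∣ m^f · Y and
-- cancelling m^f gives m ∣ Y.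
^-∣-^-*⇒≤ : ∀ m .{{_ : NonZero m}} e f Y → m ^ e ∣ m ^ f * Y → ¬ m ∣ Y → e ≤ f
^-∣-^-*⇒≤ m e f Y m^e∣ m∤Y with e ≤? f
... | yes e≤f = e≤f
... | no  e≰f = ⊥-elim (m∤Y (*-cancelˡ-∣ (m ^ f) {{m^n≢0 m f}} m^f*m∣))
  where
  m^f*m∣ : m ^ f * m ∣ m ^ f * Y
  m^f*m∣ = subst (_∣ m ^ f * Y) (*-comm m (m ^ f)) (∣-trans (^-monoʳ-∣ m (≰⇒> e≰f)) m^e∣)

-- p - 1 = P, q - 1 = Q, and pq - 1 = 2^a d X.
module Cofactor (a e d α β : ℕ) where

  P : ℕ
  P = 2 ^ a * d * α

  Q : ℕ
  Q = 2 ^ (a + e) * d * β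

  X : ℕ
  X = α * Q + α + 2 ^ e * β

  Q-split : Q ≡ 2 ^ a * 2 ^ e * d * β
  Q-split = cong (λ t → t * d * β) (^-distribˡ-+-* 2 a e)

  totient-factorisation : P * Q ≡ (2 ^ a * d) * (2 ^ a * d) * (2 ^ e * (α * β))
  totient-factorisation = trans (cong (P *_) Q-split) (regroup (2 ^ a) (2 ^ e) d α β)
    where
    regroup : ∀ A E d α β → A * d * α * (A * E * d * β) ≡ A * d * (A * d) * (E * (α * β))
    regroup = solve-∀

  predecessor-factorisation : (P + 1) * (Q + 1) ∸ 1 ≡ 2 ^ a * d * X
  predecessor-factorisation = begin
    (P + 1) * (Q + 1) ∸ 1       ≡⟨ cong (_∸ 1) (expand P Q) ⟩
    suc (P * Q + P + Q) ∸ 1     ≡⟨⟩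
    P * Q + P + Q               ≡⟨ cong (λ t → P * t + P + t) Q-split ⟩
    P * Q′ + P + Q′             ≡⟨ factor (2 ^ a) (2 ^ e) d α β ⟩
    2 ^ a * d * (α * Q′ + α + 2 ^ e * β) ≡⟨ cong (λ t → 2 ^ a * d * (α * t + α + 2 ^ e * β)) (sym Q-split) ⟩
    2 ^ a * d * X               ∎
    where
    open ≡-Reasoning
    Q′ : ℕ
    Q′ = 2 ^ a * 2 ^ e * d * β
    expand : ∀ P Q → (P + 1) * (Q + 1) ≡ suc (P * Q + P + Q)
    expand = solve-∀
    factor : ∀ A E d α β →
      A * d * α * (A * E * d * β) + A * d * α + A * E * d * β ≡ A * d * (α * (A * E * d * β) + α + E * β)
    factor = solve-∀

  power-factorisation : ∀ j →
    ((P + 1) * (Q + 1) ∸ 1) ^ (2 + j) ≡ (2 ^ a * d) * (2 ^ a * d) * (2 ^ (a * j) * d ^ j * X ^ (2 + j))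
  power-factorisation j = begin
    ((P + 1) * (Q + 1) ∸ 1) ^ (2 + j)           ≡⟨ cong (_^ (2 + j)) predecessor-factorisation ⟩
    Ad * X * (Ad * X * (Ad * X) ^ j)            ≡⟨ cong (λ t → Ad * X * (Ad * X * t)) split-power ⟩
    Ad * X * (Ad * X * (2 ^ (a * j) * d ^ j * X ^ j)) ≡⟨ regroup Ad X (2 ^ (a * j)) (d ^ j) (X ^ j) ⟩
    Ad * Ad * (2 ^ (a * j) * d ^ j * X ^ (2 + j)) ∎
    where
    open ≡-Reasoning
    Ad : ℕ
    Ad = 2 ^ a * d
    split-power : (Ad * X) ^ j ≡ 2 ^ (a * j) * d ^ j * X ^ j
    split-power = begin
      (Ad * X) ^ j                  ≡⟨ ^-distribʳ-* Ad X j ⟩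
      Ad ^ j * X ^ j                ≡⟨ cong (_* X ^ j) (^-distribʳ-* (2 ^ a) d j) ⟩
      (2 ^ a) ^ j * d ^ j * X ^ j   ≡⟨ cong (λ t → t * d ^ j * X ^ j) (^-*-assoc 2 a j) ⟩
      2 ^ (a * j) * d ^ j * X ^ j   ∎
    regroup : ∀ Ad X T D Y → Ad * X * (Ad * X * (T * D * Y)) ≡ Ad * Ad * (T * D * (X * (X * Y)))
    regroup = solve-∀

  -- X is coprime to α: a common divisor of α and X divides 2^e β, which is
  -- coprime to the odd number α.
  coprime-α-X : ¬ 2 ∣ α → Coprime α β → Coprime α X
  coprime-α-X α-odd α⊥β {c} (c∣α , c∣X) = α⊥2^eβ (c∣α , c∣2^eβ)
    where
    α⊥2^eβ : Coprime α (2 ^ e * β)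
    α⊥2^eβ = coprime-*ʳ (coprime-^ʳ e (∤⇒coprime prime[2] α-odd)) α⊥β
    c∣2^eβ : c ∣ 2 ^ e * β
    c∣2^eβ = ∣m+n∣m⇒∣n c∣X (∣m∣n⇒∣m+n (∣-trans c∣α (m∣m*n Q)) c∣α)

  -- X is coprime to β: X ≡ β (α 2^(a+e) d + 2^e) + α.
  coprime-β-X : Coprime α β → Coprime β X
  coprime-β-X α⊥β {c} (c∣β , c∣X) = coprime-sym α⊥β (c∣β , c∣α)
    where
    rearrange : ∀ α T d β E → α * (T * d * β) + α + E * β ≡ β * (α * T * d + E) + α
    rearrange = solve-∀
    c∣α : c ∣ α
    c∣α = ∣m+n∣m⇒∣n (subst (c ∣_) (rearrange α (2 ^ (a + e)) d β (2 ^ e)) c∣X) (∣-trans c∣β (m∣m*n _))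

  -- For e ≥ 1 both Q and 2^e β are even, so X ≡ α (mod 2) is odd.
  X-odd : ∀ {e′} → e ≡ suc e′ → ¬ 2 ∣ α → ¬ 2 ∣ X
  X-odd {e′} refl α-odd 2∣X = α-odd (∣m+n∣m⇒∣n 2∣αQ+α (∣n⇒∣m*n α 2∣Q))
    where
    2∣Q : 2 ∣ Q
    2∣Q = subst (λ t → 2 ∣ 2 ^ t * d * β) (sym (+-suc a e′))
                (∣m⇒∣m*n β (∣m⇒∣m*n d (m∣m*n (2 ^ (a + e′)))))
    2∣2^eβ : 2 ∣ 2 ^ e * β
    2∣2^eβ = ∣m⇒∣m*n β (m∣m*n (2 ^ e′))
    2∣αQ+α : 2 ∣ α * Q + α
    2∣αQ+α = ∣m+n∣m⇒∣n (subst (2 ∣_) (+-comm (α * Q + α) (2 ^ e * β)) 2∣X) 2∣2^eβ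

  lehmer-reduction : ∀ j → ¬ 2 ∣ d → Prime (P + 1) → Prime (Q + 1) → P + 1 ≢ Q + 1 →
    InL (2 + j) ((P + 1) * (Q + 1)) ⇔ 2 ^ e * (α * β) ∣ 2 ^ (a * j) * d ^ j * X ^ (2 + j)
  lehmer-reduction j d-odd p-prime q-prime p≢q =
    mk⇔ (λ lehmer → *-cancelˡ-∣ N {{N≢0}} (subst₂ _∣_ φ-eq power-eq lehmer))
        (λ reduced → subst₂ _∣_ (sym φ-eq) (sym power-eq) (*-monoʳ-∣ N reduced))
    where
    N : ℕ
    N = (2 ^ a * d) * (2 ^ a * d)
    N≢0 : NonZero N
    N≢0 = m*n≢0 (2 ^ a * d) (2 ^ a * d) {{Ad≢0}} {{Ad≢0}}
      where
      Ad≢0 : NonZero (2 ^ a * d)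
      Ad≢0 = m*n≢0 (2 ^ a) d {{m^n≢0 2 a}} {{odd⇒nonZero d-odd}}
    φ-eq : φ ((P + 1) * (Q + 1)) ≡ N * (2 ^ e * (α * β))
    φ-eq = trans (totient-shifted P Q p-prime q-prime p≢q) totient-factorisation
    power-eq : ((P + 1) * (Q + 1) ∸ 1) ^ (2 + j) ≡ N * (2 ^ (a * j) * d ^ j * X ^ (2 + j))
    power-eq = power-factorisation j

  -- The reduced condition splits into its 2-part and its odd part: X is odd
  -- when e ≥ 1, and α β is coprime to both 2 and X.
  two-adic-criterion : ∀ j → ¬ 2 ∣ d → ¬ 2 ∣ α → ¬ 2 ∣ β → Coprime α β →
    2 ^ e * (α * β) ∣ 2 ^ (a * j) * d ^ j * X ^ (2 + j) ⇔ (e ≤ a * j × α * β ∣ d ^ j)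
  two-adic-criterion j d-odd α-odd β-odd α⊥β = mk⇔ to from
    where
    k : ℕ
    k = 2 + j
    αβ⊥X^k : Coprime (α * β) (X ^ k)
    αβ⊥X^k = coprime-^ʳ k (coprime-*ˡ (coprime-α-X α-odd α⊥β) (coprime-β-X α⊥β))
    αβ⊥2^aj : Coprime (α * β) (2 ^ (a * j))
    αβ⊥2^aj = coprime-^ʳ (a * j) (coprime-*ˡ (∤⇒coprime prime[2] α-odd) (∤⇒coprime prime[2] β-odd))
    -- Stated for any e₀ ≡ e so that the cases e = 0 and e ≥ 1 can be split.
    two-part : ∀ {e₀} → e ≡ e₀ → 2 ^ e₀ ∣ 2 ^ (a * j) * (d ^ j * X ^ k) → e₀ ≤ a * j
    two-part {zero}   _    _     = z≤n
    two-part {suc e′} e≡e₀ 2^e∣ = ^-∣-^-*⇒≤ 2 (suc e′) (a * j) (d ^ j * X ^ k) 2^e∣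
                                    (odd-* (odd-^ j d-odd) (odd-^ k (X-odd e≡e₀ α-odd)))
    odd-part : α * β ∣ 2 ^ (a * j) * (X ^ k * d ^ j) → α * β ∣ d ^ j
    odd-part αβ∣ = coprime-divisor αβ⊥X^k (coprime-divisor αβ⊥2^aj αβ∣)
    rearrange : ∀ T D Y → T * D * Y ≡ T * (Y * D)
    rearrange = solve-∀
    to : 2 ^ e * (α * β) ∣ 2 ^ (a * j) * d ^ j * X ^ k → e ≤ a * j × α * β ∣ d ^ j
    to dvd = two-part refl (subst (2 ^ e ∣_) (*-assoc (2 ^ (a * j)) (d ^ j) (X ^ k)) (m*n∣⇒m∣ (2 ^ e) (α * β) dvd))
           , odd-part (subst (α * β ∣_) (rearrange (2 ^ (a * j)) (d ^ j) (X ^ k)) (m*n∣⇒n∣ (2 ^ e) (α * β) dvd))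
    from : e ≤ a * j × α * β ∣ d ^ j → 2 ^ e * (α * β) ∣ 2 ^ (a * j) * d ^ j * X ^ k
    from (e≤aj , αβ∣d^j) = ∣m⇒∣m*n (X ^ k) (*-pres-∣ (^-monoʳ-∣ 2 e≤aj) αβ∣d^j)

exponent-condition : ∀ a e j → e ≤ a * j ⇔ a + (a + e) ≤ (2 + j) * a
exponent-condition a e j = mk⇔
  (λ e≤aj → +-monoʳ-≤ a (+-monoʳ-≤ a (subst (e ≤_) (*-comm a j) e≤aj)))
  (λ le → subst (e ≤_) (*-comm j a) (+-cancelˡ-≤ a e (j * a) (+-cancelˡ-≤ a (a + e) (a + j * a) le)))

mainTheorem2 : (p q k a b d α β : ℕ) →
    Prime p → Prime q → p ≢ q → ¬ (2 ∣ p) → ¬ (2 ∣ q) → 2 ≤ k →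
    1 ≤ a → 1 ≤ b → a ≤ b →
    ¬ (2 ∣ d) → ¬ (2 ∣ α) → ¬ (2 ∣ β) → Coprime α β →
    p ≡ 2 ^ a * d * α + 1 → q ≡ 2 ^ b * d * β + 1 →
    InL k (p * q) ⇔ (a + b ≤ k * a × (α * β) ∣ d ^ (k ∸ 2))
mainTheorem2 _ _ zero          _ _ _ _ _ _ _ _ _ _ ()
mainTheorem2 _ _ (suc zero)    _ _ _ _ _ _ _ _ _ _ (s≤s ())
mainTheorem2 _ _ (suc (suc j)) a b d α β p-prime q-prime p≢q _ _ _ _ _ a≤b
             d-odd α-odd β-odd α⊥β refl refl
  with e , refl ← m≤n⇒∃[o]m+o≡n a≤b =
  (exponent-condition a e j ×-⇔ ⇔.refl)
    ⇔-∘ (two-adic-criterion j d-odd α-odd β-odd α⊥β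
    ⇔-∘ lehmer-reduction j d-odd p-prime q-prime p≢q)
  where open Cofactor a e d α β
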